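{- There are infinitely many non-primitive Pythagorean triples $(x,y,z)$ such that exactly two of the three components $x,y,z$ are numeric palindromes.
   Context: A Pythagorean triple is a triple $(x,y,z)$ of positive integers with $x^2+y^2=z^2$; it is primitive if $\gcd(x,y,z)=1$ and non-primitive otherwise. A numeric palindrome is a positive integer whose decimal representation (without leading zeros) reads the same forwards and backwards. -}

module Defs where

open import Data.Nat using (ℕ; zero; suc; _+_; _*_; _<_; _>_; _≤_; s≤s; z≤n)
open import Data.Nat.DivMod using (_/_; _%_)
open import Data.Nat.GCD using (gcd)
open import Data.List using (List; []; _∷_; reverse)
open import Data.Product using (_×_)
open import Data.Sum using (_⊎_)
open import Data.Empty using (⊥)
open import Relation.Binary.PropositionalEquality using (_≡_; _≢_)
open import Relation.Nullary using (¬_)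

-- Decimal digits of n, least significant first; digits 0 = [].
-- (no leading zeros: the most significant digit, last in the list, is nonzero)
-- fuel-bounded helper: with fuel ≥ n it computes all digits of n
-- (n / 10 < n for n > 0, so fuel n always suffices)
digitsFuel : ℕ → ℕ → List ℕ
digitsFuel zero _ = []
digitsFuel (suc f) zero = []
digitsFuel (suc f) (suc n) = (suc n % 10) ∷ digitsFuel f (suc n / 10)

digits : ℕ → List ℕ
digits n = digitsFuel n n

IsPalindrome : ℕ → Set
IsPalindrome n = (0 < n) × (reverse (digits n) ≡ digits n)

IsPythTriple : ℕ → ℕ → ℕ → Set
IsPythTriple x y z = (0 < x) × (0 < y) × (0 < z) × (x * x + y * y ≡ z * z)

NonPrimitive : ℕ → ℕ → ℕ → Set
NonPrimitive x y z = gcd (gcd x y) z ≢ 1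

ExactlyTwo : (ℕ → Set) → ℕ → ℕ → ℕ → Set
ExactlyTwo P x y z =
    (P x × P y × ¬ P z)
  ⊎ (P x × ¬ P y × P z)
  ⊎ (¬ P x × P y × P z)

module Submission where

-- The triples are the multiples of (6, 8, 10) by  R = 10^(N+1) + 1 = 10…01:
--
--     x = 6·R = 60…06,   y = 8·R = 80…08,   z = 10·R = 10…010.
--
-- (6R)² + (8R)² = (10R)² and 2 divides all three, so the triple is
-- non-primitive.  For a digit c the number c·R has decimal digits
-- c 0…0 c, a palindrome; z ends in the digit 0 while its leading digit
-- is nonzero, so z is not a palindrome.  Since z > R > N the family is
-- unbounded.

open import Defs
open import Data.Nat using (ℕ; zero; suc; _+_; _*_; _^_; _<_; _≤_; _<?_; s≤s; z≤n)
open import Data.Nat.Properties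
open import Data.Nat.DivMod
open import Data.Nat.GCD using (gcd-greatest)
open import Data.Nat.Divisibility using (_∣_; divides; ∣-trans; m∣m*n; ∣1⇒≡1)
open import Data.List using (List; []; _∷_; [_]; reverse; replicate; _++_; _∷ʳ_)
open import Data.List.Properties using (unfold-reverse; reverse-++; ∷-injectiveˡ)
open import Data.Product using (Σ; _×_; _,_)
open import Data.Sum using (inj₁)
open import Relation.Binary.PropositionalEquality using (_≡_; _≢_; refl; sym; trans; cong; cong₂; subst; module ≡-Reasoning)
open import Relation.Nullary using (¬_; Dec)
open import Relation.Nullary.Decidable using (True; toWitness)
open import Data.Nat.Solver using (module +-*-Solver)
open +-*-Solver using (solve; _:+_; _:*_; _:=_; con)

digitsFuel-zero : ∀ f → digitsFuel f 0 ≡ []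
digitsFuel-zero zero    = refl
digitsFuel-zero (suc f) = refl

quotient-decreases : ∀ n → suc n / 10 ≤ n
quotient-decreases n = ≤-pred (m/n<m (suc n) 10 (s≤s (s≤s z≤n)))

digitsFuel-stable : ∀ f g n → n ≤ f → n ≤ g → digitsFuel f n ≡ digitsFuel g n
digitsFuel-stable zero    g       zero    _       _       = sym (digitsFuel-zero g)
digitsFuel-stable (suc f) zero    zero    _       _       = refl
digitsFuel-stable (suc f) (suc g) zero    _       _       = refl
digitsFuel-stable (suc f) (suc g) (suc n) (s≤s p) (s≤s q) =
  cong (suc n % 10 ∷_)
       (digitsFuel-stable f g (suc n / 10)
         (≤-trans (quotient-decreases n) p) (≤-trans (quotient-decreases n) q))

digits-suc : ∀ n → digits (suc n) ≡ suc n % 10 ∷ digits (suc n / 10)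
digits-suc n =
  cong (suc n % 10 ∷_)
       (digitsFuel-stable n (suc n / 10) (suc n / 10) (quotient-decreases n) ≤-refl)

digits-cons : ∀ d m → d < 10 → 0 < d + m * 10 → digits (d + m * 10) ≡ d ∷ digits m
digits-cons d m d<10 pos with d + m * 10 in eq
... | suc n = begin
    digits (suc n)                        ≡⟨ digits-suc n ⟩
    suc n % 10 ∷ digits (suc n / 10)      ≡⟨ cong₂ (λ a b → a % 10 ∷ digits (b / 10)) (sym eq) (sym eq) ⟩
    lastDigit ∷ digits ((d + m * 10) / 10) ≡⟨ cong₂ (λ a b → a ∷ digits b) lastDigit≡d quotient≡m ⟩
    d ∷ digits m                          ∎
  where
  open ≡-Reasoning
  lastDigit = (d + m * 10) % 10
  lastDigit≡d : lastDigit ≡ d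
  lastDigit≡d = trans ([m+kn]%n≡m%n d m 10) (m<n⇒m%n≡m d<10)
  quotient≡m : (d + m * 10) / 10 ≡ m
  quotient≡m = begin
    (d + m * 10) / 10      ≡⟨ +-distrib-/-∣ʳ d (divides m refl) ⟩
    d / 10 + m * 10 / 10   ≡⟨ cong₂ _+_ (m<n⇒m/n≡0 d<10) (m*n/n≡m m 10) ⟩
    m                      ∎

digitsFuel-leading : ∀ f n → 0 < n → n ≤ f →
  Σ (List ℕ) λ ds → Σ ℕ λ d → digitsFuel f n ≡ ds ∷ʳ suc d
digitsFuel-leading (suc f) (suc n) _ (s≤s n≤f) with suc n / 10 in q
... | zero  = [] , n , cong₂ _∷_ (m<n⇒m%n≡m (m/n≡0⇒m<n {suc n} {10} q)) (digitsFuel-zero f)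
... | suc k with digitsFuel-leading f (suc k) (s≤s z≤n)
                   (≤-trans (subst (_≤ n) q (quotient-decreases n)) n≤f)
...   | ds , d , eq = suc n % 10 ∷ ds , d , cong (suc n % 10 ∷_) eq

digits-leading : ∀ n → 0 < n → Σ (List ℕ) λ ds → Σ ℕ λ d → digits n ≡ ds ∷ʳ suc d
digits-leading n pos = digitsFuel-leading n n pos ≤-refl

digits-digitTimesPow : ∀ c n → 0 < c → c < 10 → digits (c * 10 ^ n) ≡ replicate n 0 ++ [ c ]
digits-digitTimesPow c zero 0<c c<10 = begin
    digits (c * 1)      ≡⟨ cong digits (trans (*-identityʳ c) (sym (+-identityʳ c))) ⟩
    digits (c + 0 * 10) ≡⟨ digits-cons c 0 c<10 (≤-trans 0<c (m≤m+n c 0)) ⟩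
    [ c ]               ∎
  where open ≡-Reasoning
digits-digitTimesPow c (suc n) 0<c c<10 = begin
    digits (c * 10 ^ suc n)        ≡⟨ cong digits (shift c (10 ^ n)) ⟩
    digits (0 + c * 10 ^ n * 10)   ≡⟨ digits-cons 0 (c * 10 ^ n) (s≤s z≤n) pos ⟩
    0 ∷ digits (c * 10 ^ n)        ≡⟨ cong (0 ∷_) (digits-digitTimesPow c n 0<c c<10) ⟩
    0 ∷ replicate n 0 ++ [ c ]     ∎
  where
  open ≡-Reasoning
  shift : ∀ c p → c * (10 * p) ≡ 0 + c * p * 10
  shift = solve 2 (λ c p → c :* (con 10 :* p) := con 0 :+ c :* p :* con 10) refl
  pos : 0 < c * 10 ^ n * 10
  pos = ≤-trans (*-mono-≤ 0<c (m^n>0 10 n)) (m≤m*n (c * 10 ^ n) 10)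

oneZerosOne : ℕ → ℕ
oneZerosOne n = 1 + 10 ^ suc n

oneZerosOne-pos : ∀ n → 0 < oneZerosOne n
oneZerosOne-pos n = s≤s z≤n

reverse-replicate : ∀ {A : Set} n (a : A) → reverse (replicate n a) ≡ replicate n a
reverse-replicate zero    a = refl
reverse-replicate (suc n) a = begin
    reverse (a ∷ replicate n a)  ≡⟨ unfold-reverse a (replicate n a) ⟩
    reverse (replicate n a) ∷ʳ a ≡⟨ cong (_∷ʳ a) (reverse-replicate n a) ⟩
    replicate n a ∷ʳ a           ≡⟨ snoc n ⟩
    a ∷ replicate n a            ∎
  where
  open ≡-Reasoning
  snoc : ∀ n → replicate n a ∷ʳ a ≡ a ∷ replicate n a
  snoc zero    = refl
  snoc (suc n) = cong (a ∷_) (snoc n)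

digits-digitTimesOneZerosOne : ∀ c n → 0 < c → c < 10 →
  digits (c * oneZerosOne n) ≡ c ∷ replicate n 0 ++ [ c ]
digits-digitTimesOneZerosOne c n 0<c c<10 = begin
    digits (c * (1 + 10 * 10 ^ n))  ≡⟨ cong digits (split c (10 ^ n)) ⟩
    digits (c + c * 10 ^ n * 10)    ≡⟨ digits-cons c (c * 10 ^ n) c<10 (≤-trans 0<c (m≤m+n c _)) ⟩
    c ∷ digits (c * 10 ^ n)         ≡⟨ cong (c ∷_) (digits-digitTimesPow c n 0<c c<10) ⟩
    c ∷ replicate n 0 ++ [ c ]      ∎
  where
  open ≡-Reasoning
  split : ∀ c p → c * (1 + 10 * p) ≡ c + c * p * 10
  split = solve 2 (λ c p → c :* (con 1 :+ con 10 :* p) := c :+ c :* p :* con 10) refl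

digitTimesOneZerosOne-palindrome : ∀ c n → 0 < c → c < 10 → IsPalindrome (c * oneZerosOne n)
digitTimesOneZerosOne-palindrome c n 0<c c<10 =
  *-mono-≤ 0<c (oneZerosOne-pos n) , (begin
    reverse (digits (c * oneZerosOne n))  ≡⟨ cong reverse eq ⟩
    reverse (c ∷ replicate n 0 ++ [ c ])  ≡⟨ reverse-++ (c ∷ replicate n 0) [ c ] ⟩
    c ∷ reverse (c ∷ replicate n 0)       ≡⟨ cong (c ∷_) (unfold-reverse c (replicate n 0)) ⟩
    c ∷ reverse (replicate n 0) ∷ʳ c      ≡⟨ cong (λ zs → c ∷ zs ∷ʳ c) (reverse-replicate n 0) ⟩
    c ∷ replicate n 0 ++ [ c ]            ≡⟨ sym eq ⟩
    digits (c * oneZerosOne n)            ∎)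
  where
  open ≡-Reasoning
  eq = digits-digitTimesOneZerosOne c n 0<c c<10

-- A positive multiple of 10 is not a palindrome: read backwards it starts
-- with its nonzero leading digit, forwards with the digit 0.
multipleOfTen-notPalindrome : ∀ m → 0 < m → ¬ IsPalindrome (10 * m)
multipleOfTen-notPalindrome m 0<m (_ , pal) with digits-leading m 0<m
... | ds , d , eq = 1+d≢0 (∷-injectiveˡ (begin
    suc d ∷ reverse ds ∷ʳ 0          ≡⟨ cong (_∷ʳ 0) (reverse-++ ds [ suc d ]) ⟨
    reverse (ds ∷ʳ suc d) ∷ʳ 0       ≡⟨ unfold-reverse 0 (ds ∷ʳ suc d) ⟨
    reverse (0 ∷ ds ∷ʳ suc d)        ≡⟨ cong reverse digits10m ⟨
    reverse (digits (10 * m))        ≡⟨ pal ⟩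
    digits (10 * m)                  ≡⟨ digits10m ⟩
    0 ∷ ds ∷ʳ suc d                  ∎))
  where
  open ≡-Reasoning
  1+d≢0 : suc d ≢ 0
  1+d≢0 ()
  digits10m : digits (10 * m) ≡ 0 ∷ ds ∷ʳ suc d
  digits10m = begin
    digits (10 * m)      ≡⟨ cong digits (*-comm 10 m) ⟩
    digits (0 + m * 10)  ≡⟨ digits-cons 0 m (s≤s z≤n) (≤-trans 0<m (m≤m*n m 10)) ⟩
    0 ∷ digits m         ≡⟨ cong (0 ∷_) eq ⟩
    0 ∷ ds ∷ʳ suc d      ∎

multiple-6-8-10-pythTriple : ∀ r → 0 < r → IsPythTriple (6 * r) (8 * r) (10 * r)
multiple-6-8-10-pythTriple r 0<r = pos 6 (s≤s z≤n) , pos 8 (s≤s z≤n) , pos 10 (s≤s z≤n) , squares r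
  where
  pos : ∀ c → 0 < c → 0 < c * r
  pos c 0<c = *-mono-≤ 0<c 0<r
  squares : ∀ r → 6 * r * (6 * r) + 8 * r * (8 * r) ≡ 10 * r * (10 * r)
  squares = solve 1 (λ r → con 6 :* r :* (con 6 :* r) :+ con 8 :* r :* (con 8 :* r)
                           := con 10 :* r :* (con 10 :* r)) refl

commonDivisor-nonPrimitive : ∀ d x y z → 1 < d → d ∣ x → d ∣ y → d ∣ z → NonPrimitive x y z
commonDivisor-nonPrimitive d x y z 1<d d∣x d∣y d∣z gcd≡1 =
  <⇒≢ 1<d (sym (∣1⇒≡1 (subst (d ∣_) gcd≡1 (gcd-greatest (gcd-greatest d∣x d∣y) d∣z))))

n<m^n : ∀ m n → 1 < m → n < m ^ n
n<m^n m zero    _   = s≤s z≤n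
n<m^n m (suc n) 1<m = ≤-<-trans (n<m^n m n 1<m) (^-monoʳ-< m 1<m (n<1+n n))

theorem3p3 : (N : ℕ) → Σ ℕ λ x → Σ ℕ λ y → Σ ℕ λ z →
    IsPythTriple x y z × NonPrimitive x y z × ExactlyTwo IsPalindrome x y z × (N < z)
theorem3p3 N =
  6 * R , 8 * R , 10 * R ,
  multiple-6-8-10-pythTriple R (oneZerosOne-pos N) ,
  commonDivisor-nonPrimitive 2 (6 * R) (8 * R) (10 * R) (decide (1 <? 2))
    (evenFactor 3) (evenFactor 4) (evenFactor 5) ,
  inj₁ ( digitTimesOneZerosOne-palindrome 6 N (decide (0 <? 6)) (decide (6 <? 10))
       , digitTimesOneZerosOne-palindrome 8 N (decide (0 <? 8)) (decide (8 <? 10))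
       , multipleOfTen-notPalindrome R (oneZerosOne-pos N) ) ,
  N<z
  where
  R = oneZerosOne N
  decide : ∀ {P : Set} (P? : Dec P) {_ : True P?} → P
  decide _ {p} = toWitness p
  evenFactor : ∀ k → 2 ∣ (k * 2) * R
  evenFactor k = ∣-trans (divides k refl) (m∣m*n R)
  N<z : N < 10 * R
  N<z = begin-strict
    N            <⟨ n<m^n 10 N (decide (1 <? 10)) ⟩
    10 ^ N       <⟨ ^-monoʳ-< 10 (decide (1 <? 10)) (n<1+n N) ⟩
    10 ^ suc N   <⟨ n<1+n (10 ^ suc N) ⟩
    R            ≤⟨ m≤n*m R 10 ⟩
    10 * R       ∎
    where open ≤-Reasoning
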